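{- Let $h\geq 5$ be an integer and let $A=\{0,1,2,3,5,6,\ldots,h+1\}$ (that is, $[0,h+1]\setminus\{4\}$). Then $|h^{\wedge}_{\pm}A|\geq h^2+h+2$.
   Context: For a finite set $A=\{a_1,\ldots,a_k\}$ of integers and a positive integer $h$, the restricted $h$-fold signed sumset is $h^{\wedge}_{\pm}A=\left\{\sum_{i=1}^{k}\lambda_i a_i : \lambda_i\in\{ -1,0,1\} \text{ for all } i,\ \sum_{i=1}^{k}|\lambda_i| = h\right\}$. For integers $a\le b$, $[a,b]=\{n\in\mathbb{Z}: a\le n\le b\}$. -}

module Defs where

open import Data.Nat using (ℕ; zero; suc)
open import Data.Integer using (ℤ; +_; _+_; -_)
open import Data.Integer.Properties using (_≟_)
open import Data.List using (List; []; _∷_; _++_; map; length; deduplicate; filter; upTo)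
open import Relation.Nullary.Decidable using (¬?)

-- signedSums h as : the list (with repetitions) of all sums Σ λᵢ aᵢ with
-- λᵢ ∈ {-1,0,1} and Σ |λᵢ| = h, where as = [a₁,…,a_k] (indices are positions).
signedSums : ℕ → List ℤ → List ℤ
signedSums zero    []       = + 0 ∷ []
signedSums (suc h) []       = []
signedSums zero    (a ∷ as) = signedSums zero as
signedSums (suc h) (a ∷ as) =
  signedSums (suc h) as
  ++ map (λ s → a + s) (signedSums h as)
  ++ map (λ s → (- a) + s) (signedSums h as)

signedSumsetCard : ℕ → List ℤ → ℕ
signedSumsetCard h A = length (deduplicate _≟_ (signedSums h A))

A-set : ℕ → List ℤ
A-set h = map +_ (filter (λ n → ¬? (n Data.Nat.≟ 4)) (upTo (suc (suc h))))

-- Signed sums of A-set (5 + k) fill the whole interval [-σ k, σ k], where σ k is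
-- the largest signed sum.  For k = 0 this is a finite check; passing from
-- A-set h to A-set (h + 1) adjoins c = h + 2 ≤ σ, and every n ≤ σ + c is then
-- either (n - c) + c or -(c - n) + c with the first summand already a signed
-- sum of A-set h (signed sums are closed under negation).  Hence the sumset has
-- at least 2σ + 1 = h² + 3h - 5 ≥ h² + h + 2 elements.
module Submission where

open import Defs
open import Data.Nat using (ℕ; zero; suc; _≤_; _+_; _*_; _∸_; _≤?_; z≤n; s≤s; s≤s⁻¹)
import Data.Nat.Properties as ℕ
open import Data.Nat.Tactic.RingSolver using (solve-∀)
open import Data.Fin using (Fin; toℕ)
open import Data.Fin.Properties using (injective⇒≤; toℕ-injective; toℕ<n)
open import Data.Integer as ℤ using (ℤ; +_; -_; _⊖_)
import Data.Integer.Properties as ℤ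
open import Data.List using (List; []; _∷_; _++_; [_]; map; length; deduplicate; filter; upTo; lookup)
import Data.List.Properties as List
open import Data.List.Membership.Propositional using (_∈_)
open import Data.List.Membership.Propositional.Properties
  using (∈-map⁺; ∈-map⁻; ∈-++⁺ˡ; ∈-++⁺ʳ; ∈-++⁻; ∈-deduplicate⁺)
open import Data.List.Membership.DecPropositional ℤ._≟_ using (_∈?_)
open import Data.List.Relation.Unary.Any using (here; there; index)
open import Data.List.Relation.Unary.Any.Properties using (lookup-index)
open import Data.List.Relation.Unary.All using (all?)
open import Data.List.Relation.Unary.All.Properties using (applyUpTo⁻)
open import Data.Product using (_,_)
open import Data.Sum using (inj₁; inj₂)
open import Function.Base using (_∘_)
open import Function.Definitions using (Injective)
open import Data.Empty using (⊥-elim)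
open import Relation.Binary.Definitions using (tri<; tri≈; tri>)
open import Relation.Nullary using (yes; no)
open import Relation.Nullary.Decidable using (toWitness; ¬?)
open import Relation.Binary.PropositionalEquality
  using (_≡_; _≢_; refl; sym; trans; cong; subst; module ≡-Reasoning)

private
  variable
    n : ℕ
    s t x y : ℤ

±_ : ℤ → List ℤ
± x = x ∷ - x ∷ []

±-neg : y ∈ ± x → - y ∈ ± x
±-neg (here refl)         = there (here refl)
±-neg (there (here refl)) = here (ℤ.neg-involutive _)

data SignedSum∷ (h : ℕ) (x : ℤ) (as : List ℤ) : ℤ → Set where
  skip : s ∈ signedSums (suc h) as → SignedSum∷ h x as s
  take : y ∈ ± x → t ∈ signedSums h as → SignedSum∷ h x as (y ℤ.+ t)

signedSums-∷⁻ : ∀ h x as → s ∈ signedSums (suc h) (x ∷ as) → SignedSum∷ h x as s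
signedSums-∷⁻ h x as p with ∈-++⁻ (signedSums (suc h) as) p
... | inj₁ q = skip q
... | inj₂ q with ∈-++⁻ (map (λ s → x ℤ.+ s) (signedSums h as)) q
...   | inj₁ r with _ , t∈ , refl ← ∈-map⁻ _ r = take (here refl) t∈
...   | inj₂ r with _ , t∈ , refl ← ∈-map⁻ _ r = take (there (here refl)) t∈

signedSums-skip : ∀ h x as → s ∈ signedSums h as → s ∈ signedSums h (x ∷ as)
signedSums-skip zero    x as p = p
signedSums-skip (suc h) x as p = ∈-++⁺ˡ p

signedSums-take : ∀ h x as → y ∈ ± x → t ∈ signedSums h as → y ℤ.+ t ∈ signedSums (suc h) (x ∷ as)
signedSums-take h x as (here refl) p =
  ∈-++⁺ʳ (signedSums (suc h) as) (∈-++⁺ˡ (∈-map⁺ _ p))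
signedSums-take h x as (there (here refl)) p =
  ∈-++⁺ʳ (signedSums (suc h) as) (∈-++⁺ʳ (map (λ s → x ℤ.+ s) (signedSums h as)) (∈-map⁺ _ p))

signedSums-neg : ∀ h as → s ∈ signedSums h as → - s ∈ signedSums h as
signedSums-neg zero    []       (here refl) = here refl
signedSums-neg zero    (x ∷ as) p = signedSums-neg zero as p
signedSums-neg (suc h) (x ∷ as) p with signedSums-∷⁻ h x as p
... | skip q               = signedSums-skip (suc h) x as (signedSums-neg (suc h) as q)
... | take {y} {t} y∈ t∈ = subst (_∈ signedSums (suc h) (x ∷ as)) (sym (ℤ.neg-distrib-+ y t))
  (signedSums-take h x as (±-neg y∈) (signedSums-neg h as t∈))

signedSums-++⁺ : ∀ h as g bs → s ∈ signedSums h as → t ∈ signedSums g bs →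
                 s ℤ.+ t ∈ signedSums (h + g) (as ++ bs)
signedSums-++⁺ zero    []       g bs (here refl) q =
  subst (_∈ signedSums g bs) (sym (ℤ.+-identityˡ _)) q
signedSums-++⁺ zero    (x ∷ as) g bs p q =
  signedSums-skip g x (as ++ bs) (signedSums-++⁺ zero as g bs p q)
signedSums-++⁺ {t = t} (suc h) (x ∷ as) g bs p q with signedSums-∷⁻ h x as p
... | skip p′            = signedSums-skip (suc h + g) x (as ++ bs) (signedSums-++⁺ (suc h) as g bs p′ q)
... | take {y} {u} y∈ u∈ = subst (_∈ signedSums (suc h + g) (x ∷ as ++ bs)) (sym (ℤ.+-assoc y u t))
  (signedSums-take (h + g) x (as ++ bs) y∈ (signedSums-++⁺ h as g bs u∈ q))

signedSums-∷ʳ⁺ : ∀ h as x → s ∈ signedSums h as → s ℤ.+ x ∈ signedSums (suc h) (as ++ [ x ])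
signedSums-∷ʳ⁺ {s} h as x p =
  subst (λ k → s ℤ.+ x ∈ signedSums k (as ++ [ x ])) (ℕ.+-comm h 1)
    (signedSums-++⁺ h as 1 [ x ] p (here (sym (ℤ.+-identityʳ x))))

interval-∷ʳ : ∀ h as m c → c ≤ m → (∀ n → n ≤ m → + n ∈ signedSums h as) →
              ∀ n → n ≤ m + c → + n ∈ signedSums (suc h) (as ++ [ + c ])
interval-∷ʳ h as m c c≤m below n n≤m+c with c ≤? n
... | yes c≤n = subst (_∈ signedSums (suc h) (as ++ [ + c ])) above
  (signedSums-∷ʳ⁺ h as (+ c) (below (n ∸ c) n∸c≤m))
  where
  n∸c≤m : n ∸ c ≤ m
  n∸c≤m = ℕ.m≤n+o⇒m∸n≤o n c (subst (n ≤_) (ℕ.+-comm m c) n≤m+c)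
  above : + (n ∸ c) ℤ.+ + c ≡ + n
  above = trans (sym (ℤ.pos-+ (n ∸ c) c)) (cong +_ (ℕ.m∸n+n≡m c≤n))
... | no c≰n = subst (_∈ signedSums (suc h) (as ++ [ + c ])) below-c
  (signedSums-∷ʳ⁺ h as (+ c) (signedSums-neg h as (below (c ∸ n) c∸n≤m)))
  where
  open ≡-Reasoning
  n≤c : n ≤ c
  n≤c = ℕ.<⇒≤ (ℕ.≰⇒> c≰n)
  c∸n≤m : c ∸ n ≤ m
  c∸n≤m = ℕ.≤-trans (ℕ.m∸n≤m c n) c≤m
  below-c : - + (c ∸ n) ℤ.+ + c ≡ + n
  below-c = begin
    - + (c ∸ n) ℤ.+ + c  ≡⟨ ℤ.+-comm (- + (c ∸ n)) (+ c) ⟩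
    + c ℤ.+ - + (c ∸ n)  ≡⟨ ℤ.m-n≡m⊖n c (c ∸ n) ⟩
    c ⊖ (c ∸ n)          ≡⟨ ℤ.⊖-≥ (ℕ.m∸n≤m c n) ⟩
    + (c ∸ (c ∸ n))      ≡⟨ cong +_ (ℕ.m∸[m∸n]≡n n≤c) ⟩
    + n                  ∎

injective⇒≤length : {A : Set} {xs : List A} {f : Fin n → A} →
                    Injective _≡_ _≡_ f → (∀ i → f i ∈ xs) → n ≤ length xs
injective⇒≤length {xs = xs} {f} f-inj f∈xs = injective⇒≤ {f = λ i → index (f∈xs i)} index-inj
  where
  open ≡-Reasoning
  index-inj : Injective _≡_ _≡_ (λ i → index (f∈xs i))
  index-inj {i} {j} eq = f-inj (begin
    f i                        ≡⟨ lookup-index (f∈xs i) ⟩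
    lookup xs (index (f∈xs i)) ≡⟨ cong (lookup xs) eq ⟩
    lookup xs (index (f∈xs j)) ≡⟨ sym (lookup-index (f∈xs j)) ⟩
    f j                        ∎)

⊖-injectiveˡ : ∀ m {i j} → i ⊖ m ≡ j ⊖ m → i ≡ j
⊖-injectiveˡ m {i} {j} eq with ℕ.<-cmp i j
... | tri< i<j _ _ = ⊥-elim (ℤ.<-irrefl eq (ℤ.⊖-monoˡ-< m i<j))
... | tri≈ _ i≡j _ = i≡j
... | tri> _ _ j<i = ⊥-elim (ℤ.<-irrefl (sym eq) (ℤ.⊖-monoˡ-< m j<i))

symmetricInterval⇒≤length : ∀ m (xs : List ℤ) →
  (∀ n → n ≤ m → + n ∈ xs) → (∀ n → n ≤ m → - + n ∈ xs) → suc (m + m) ≤ length xs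
symmetricInterval⇒≤length m xs pos neg = injective⇒≤length f-inj f∈xs
  where
  f : Fin (suc (m + m)) → ℤ
  f i = toℕ i ⊖ m
  f-inj : Injective _≡_ _≡_ f
  f-inj eq = toℕ-injective (⊖-injectiveˡ m eq)
  f∈xs : ∀ i → f i ∈ xs
  f∈xs i with m ≤? toℕ i
  ... | yes m≤i = subst (_∈ xs) (sym (ℤ.⊖-≥ m≤i))
    (pos (toℕ i ∸ m) (ℕ.m≤n+o⇒m∸n≤o (toℕ i) m (s≤s⁻¹ (toℕ<n i))))
  ... | no m≰i  = subst (_∈ xs) (sym (ℤ.⊖-≰ m≰i)) (neg (m ∸ toℕ i) (ℕ.m∸n≤m m (toℕ i)))

A-set-∷ʳ : ∀ h → h ≢ 2 → A-set (suc h) ≡ A-set h ++ [ + (2 + h) ]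
A-set-∷ʳ h h≢2 = begin
  map pos (filter ≢4? (upTo (3 + h)))
    ≡⟨ cong (map pos ∘ filter ≢4?) (sym (List.upTo-∷ʳ (2 + h))) ⟩
  map pos (filter ≢4? (upTo (2 + h) ++ [ 2 + h ]))
    ≡⟨ cong (map pos) (List.filter-++ ≢4? (upTo (2 + h)) [ 2 + h ]) ⟩
  map pos (filter ≢4? (upTo (2 + h)) ++ filter ≢4? [ 2 + h ])
    ≡⟨ cong (λ l → map pos (filter ≢4? (upTo (2 + h)) ++ l))
            (List.filter-accept ≢4? (h≢2 ∘ ℕ.+-cancelˡ-≡ 2 h 2)) ⟩
  map pos (filter ≢4? (upTo (2 + h)) ++ [ 2 + h ])
    ≡⟨ List.map-++ pos (filter ≢4? (upTo (2 + h))) [ 2 + h ] ⟩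
  A-set h ++ [ + (2 + h) ] ∎
  where
  open ≡-Reasoning
  ≢4? = λ n → ¬? (n ℕ.≟ 4)
  pos = λ n → + n

-- σ k is the largest signed sum of A-set (5 + k), the sum of its 5 + k largest elements.
σ : ℕ → ℕ
σ zero    = 17
σ (suc k) = σ k + (7 + k)

7+k≤σ : ∀ k → 7 + k ≤ σ k
7+k≤σ zero    = ℕ.m≤m+n 7 10
7+k≤σ (suc k) = ℕ.+-monoˡ-≤ (7 + k) (ℕ.≤-trans (s≤s z≤n) (7+k≤σ k))

interval-A-set-5 : ∀ n → n ≤ 17 → + n ∈ signedSums 5 (A-set 5)
interval-A-set-5 n n≤17 = applyUpTo⁻ (λ i → i) 18
  (toWitness {a? = all? (λ i → + i ∈? signedSums 5 (A-set 5)) (upTo 18)} _) (s≤s n≤17)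

interval-A-set : ∀ k n → n ≤ σ k → + n ∈ signedSums (5 + k) (A-set (5 + k))
interval-A-set zero    = interval-A-set-5
interval-A-set (suc k) =
  subst (λ as → ∀ n → n ≤ σ (suc k) → + n ∈ signedSums (6 + k) as) (sym (A-set-∷ʳ (5 + k) (λ ())))
    (interval-∷ʳ (5 + k) (A-set (5 + k)) (σ k) (7 + k) (7+k≤σ k) (interval-A-set k))

σ-double : ∀ k → σ k + σ k ≡ k * k + 13 * k + 34
σ-double zero    = refl
σ-double (suc k) = begin
  (σ k + (7 + k)) + (σ k + (7 + k))      ≡⟨ regroup (σ k) k ⟩
  (σ k + σ k) + (14 + (k + k))           ≡⟨ cong (_+ (14 + (k + k))) (σ-double k) ⟩
  (k * k + 13 * k + 34) + (14 + (k + k)) ≡⟨ expand k ⟩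
  suc k * suc k + 13 * suc k + 34        ∎
  where
  open ≡-Reasoning
  regroup : ∀ s k → (s + (7 + k)) + (s + (7 + k)) ≡ (s + s) + (14 + (k + k))
  regroup = solve-∀
  expand : ∀ k → (k * k + 13 * k + 34) + (14 + (k + k)) ≡ suc k * suc k + 13 * suc k + 34
  expand = solve-∀

square+linear≤1+2σ : ∀ k → (5 + k) * (5 + k) + (5 + k) + 2 ≤ suc (σ k + σ k)
square+linear≤1+2σ k = begin
  (5 + k) * (5 + k) + (5 + k) + 2                 ≤⟨ ℕ.m≤m+n _ (k + k + 3) ⟩
  (5 + k) * (5 + k) + (5 + k) + 2 + (k + k + 3)  ≡⟨ expand k ⟩
  suc (k * k + 13 * k + 34)                       ≡⟨ cong suc (σ-double k) ⟨
  suc (σ k + σ k)                                 ∎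
  where
  open ℕ.≤-Reasoning
  expand : ∀ k → (5 + k) * (5 + k) + (5 + k) + 2 + (k + k + 3) ≡ suc (k * k + 13 * k + 34)
  expand = solve-∀

lemma2p16 : (h : ℕ) → 5 ≤ h → h * h + h + 2 ≤ signedSumsetCard h (A-set h)
lemma2p16 h 5≤h with k , refl ← ℕ.m≤n⇒∃[o]m+o≡n 5≤h =
  ℕ.≤-trans (square+linear≤1+2σ k)
    (symmetricInterval⇒≤length (σ k) (deduplicate ℤ._≟_ (signedSums (5 + k) (A-set (5 + k))))
      (λ n n≤σ → ∈-deduplicate⁺ ℤ._≟_ (interval-A-set k n n≤σ))
      (λ n n≤σ → ∈-deduplicate⁺ ℤ._≟_ (signedSums-neg (5 + k) (A-set (5 + k)) (interval-A-set k n n≤σ))))
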